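{- Let $n$ be a positive integer relatively prime to $10$. Then $n$ is a Lucas probable prime for Method A if and only if $n$ is a Lucas probable prime for Method A*.
   Context: For integers $P > 0$ and $Q$ with $D = P^2 - 4Q \ne 0$, the Lucas sequences $U_j(P,Q)$, $V_j(P,Q)$ are defined by $U_0 = 0$, $U_1 = 1$, $V_0 = 2$, $V_1 = P$, and $U_j = PU_{j-1} - QU_{j-2}$, $V_j = PV_{j-1} - QV_{j-2}$ for $j \ge 2$. Method A: let $D$ be the first element of the sequence $5, -7, 9, -11, 13, -15, \ldots$ (i.e. $(-1)^{j}(2j+5)$ for $j = 0,1,2,\dots$) for which the Jacobi symbol $(D/n) = -1$, and set $P = 1$, $Q = (1-D)/4$. Method A*: choose $D, P, Q$ as in Method A, but if $Q = -1$ (i.e. $D = 5$), replace $P$ and $Q$ both by $5$ (so $D$ is unchanged). We say $n$ is a Lucas probable prime for a method if the method produces parameters $P, Q$ (i.e. some $D$ in the sequence has $(D/n) = -1$) and $U_{n+1}(P,Q) \equiv 0 \pmod n$. -}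

module Defs where

open import Data.Nat as ℕ using (ℕ; zero; suc; _<_)
open import Data.Nat.Primality using (Prime)
open import Data.Integer using (ℤ; +_; -[1+_]; _-_; _*_; -_; 1ℤ; 0ℤ; _/_; _≟_)
open import Data.Integer.Divisibility using (_∣_)
open import Data.Product using (Σ; ∃; _×_)
open import Relation.Nullary using (¬_; yes; no)

private
  Upair : ℤ → ℤ → ℕ → ℤ × ℤ
  Upair P Q zero = 0ℤ Data.Product., 1ℤ
  Upair P Q (suc j) with Upair P Q j
  ... | a Data.Product., b = b Data.Product., (P * b - Q * a)

U : ℤ → ℤ → ℕ → ℤ
U P Q j = Data.Product.proj₁ (Upair P Q j)

data Legendre (a : ℤ) (p : ℕ) : ℤ → Set where
  leg-zero : (+ p) ∣ a → Legendre a p 0ℤ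
  leg-qr   : ¬ ((+ p) ∣ a) → (∃ λ (x : ℤ) → (+ p) ∣ (x * x - a)) → Legendre a p 1ℤ
  leg-nqr  : ¬ ((+ p) ∣ a) → ¬ (∃ λ (x : ℤ) → (+ p) ∣ (x * x - a)) → Legendre a p (- 1ℤ)

-- Jacobi symbol (a/n): product of Legendre symbols over the prime factorization of n.
-- Jacobi a n s  means  (a/n) = s.
data Jacobi (a : ℤ) : ℕ → ℤ → Set where
  jac-one  : Jacobi a 1 1ℤ
  jac-step : ∀ {p m s t} → Prime p → Legendre a p s → Jacobi a m t →
             Jacobi a (p ℕ.* m) (s * t)

Dseq : ℕ → ℤ
Dseq j = sign j (+ (2 ℕ.* j ℕ.+ 5))
  where
  sign : ℕ → ℤ → ℤ
  sign zero x = x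
  sign (suc k) x = - sign k x

-- Q = (1 - D)/4 (exact division, since D ≡ 1 mod 4)
Qof : ℤ → ℤ
Qof D = (1ℤ - D) / (+ 4)

FirstIndex : ℕ → ℕ → Set
FirstIndex n j = Jacobi (Dseq j) n (- 1ℤ) × (∀ i → i < j → ¬ Jacobi (Dseq i) n (- 1ℤ))

LucasPrpA : ℕ → Set
LucasPrpA n = Σ ℕ λ j → FirstIndex n j × ((+ n) ∣ U 1ℤ (Qof (Dseq j)) (suc n))

paramsStar : ℤ → ℤ × ℤ
paramsStar D with Qof D ≟ - 1ℤ
... | yes _ = + 5 Data.Product., + 5
... | no _  = 1ℤ Data.Product., Qof D

LucasPrpAStar : ℕ → Set
LucasPrpAStar n = Σ ℕ λ j → FirstIndex n j ×
  ((+ n) ∣ U (Data.Product.proj₁ (paramsStar (Dseq j))) (Data.Product.proj₂ (paramsStar (Dseq j))) (suc n))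

{-# OPTIONS --safe #-}
-- Methods A and A* differ only when D = 5, where A uses the Fibonacci parameters
-- (1, −1) and A* uses (5, 5). These are the twisted parameters (D, −DQ) of (1, −1):
-- the roots of x² − Dx − DQ are √D·α and −√D·β for the roots α, β of x² − Px + Q,
-- whence P·U_{2m}(D, −DQ) = D^m U_{2m}(P, Q). As n is odd, n + 1 = 2m, and as n is
-- prime to 5 it divides U_{n+1}(5, 5) = 5^m U_{n+1}(1, −1) iff it divides U_{n+1}(1, −1).
module Submission where

open import Defs
open import Data.Nat as ℕ using (ℕ; zero; suc; _<_)
open import Data.Nat.Coprimality using (Coprime; coprime-divisor)
open import Data.Nat.Divisibility as ℕ using (∣-refl; ∣-trans; ∣m∣n⇒∣m+n)
open import Data.Integer using (ℤ; +_; _-_; _*_; -_; _^_; 1ℤ; _≟_)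
open import Data.Integer.Divisibility using (_∣_)
open import Data.Integer.Divisibility.Signed as Signed using (∣ᵤ⇒∣; ∣⇒∣ᵤ)
open import Data.Integer.Properties using (abs-*; *-assoc; *-identityˡ; *-zeroʳ)
open import Data.Integer.Tactic.RingSolver using (solve-∀)
open import Data.Product using (∃-syntax; _,_; proj₁; proj₂; map; map₂)
open import Function using (id; _∘_)
open import Function.Bundles using (_⇔_; mk⇔; Equivalence)
open import Function.Properties.Equivalence using () renaming (sym to ⇔-sym)
open import Relation.Binary.PropositionalEquality
open import Relation.Nullary using (¬_; yes; no; contradiction)

disc : ℤ → ℤ → ℤ
disc P Q = P * P - + 4 * Q

Uᵗ : ℤ → ℤ → ℕ → ℤ
Uᵗ P Q = U (disc P Q) (- (disc P Q * Q))

V : ℤ → ℤ → ℕ → ℤ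
V P Q j = + 2 * U P Q (suc j) - P * U P Q j

*-distrib-recurrence : ∀ P D T x y → P * (D * y - T * x) ≡ D * (P * y) - T * (P * x)
*-distrib-recurrence = solve-∀

mutual
  U-twisted-even : ∀ P Q m → P * Uᵗ P Q (m ℕ.* 2) ≡ disc P Q ^ m * U P Q (m ℕ.* 2)
  U-twisted-even P Q zero = *-zeroʳ P
  U-twisted-even P Q (suc m) = begin
    P * (D * y - T * x)              ≡⟨ *-distrib-recurrence P D T x y ⟩
    D * (P * y) - T * (P * x)        ≡⟨ cong₂ (λ u v → D * u - T * v)
                                          (U-twisted-odd P Q m) (U-twisted-even P Q m) ⟩
    D * (e * (+ 2 * (P * b - Q * a) - P * b)) - T * (e * a)
                                     ≡⟨ step P Q e a b ⟩
    (D * e) * (P * b - Q * a)        ∎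
    where
    open ≡-Reasoning
    D = disc P Q
    T = - (D * Q)
    e = D ^ m
    a = U P Q (m ℕ.* 2)
    b = U P Q (suc (m ℕ.* 2))
    x = Uᵗ P Q (m ℕ.* 2)
    y = Uᵗ P Q (suc (m ℕ.* 2))
    step : ∀ P Q e a b → let D = P * P - + 4 * Q in
      D * (e * (+ 2 * (P * b - Q * a) - P * b)) - - (D * Q) * (e * a) ≡ (D * e) * (P * b - Q * a)
    step = solve-∀

  U-twisted-odd : ∀ P Q m → P * Uᵗ P Q (suc (m ℕ.* 2)) ≡ disc P Q ^ m * V P Q (suc (m ℕ.* 2))
  U-twisted-odd P Q zero = base P Q
    where
    base : ∀ P Q → P * + 1 ≡ + 1 * (+ 2 * (P * + 1 - Q * + 0) - P * + 1)
    base = solve-∀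
  U-twisted-odd P Q (suc m) = begin
    P * (D * z - T * y)              ≡⟨ *-distrib-recurrence P D T y z ⟩
    D * (P * z) - T * (P * y)        ≡⟨ cong₂ (λ u v → D * u - T * v)
                                          (U-twisted-even P Q (suc m)) (U-twisted-odd P Q m) ⟩
    D * ((D * e) * c) - T * (e * (+ 2 * c - P * b))
                                     ≡⟨ step P Q e a b ⟩
    (D * e) * (+ 2 * (P * (P * c - Q * b) - Q * c) - P * (P * c - Q * b)) ∎
    where
    open ≡-Reasoning
    D = disc P Q
    T = - (D * Q)
    e = D ^ m
    a = U P Q (m ℕ.* 2)
    b = U P Q (suc (m ℕ.* 2))
    c = P * b - Q * a
    y = Uᵗ P Q (suc (m ℕ.* 2))
    z = Uᵗ P Q (suc (suc (m ℕ.* 2)))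
    step : ∀ P Q e a b → let D = P * P - + 4 * Q ; c = P * b - Q * a in
      D * ((D * e) * c) - - (D * Q) * (e * (+ 2 * c - P * b))
        ≡ (D * e) * (+ 2 * (P * (P * c - Q * b) - Q * c) - P * (P * c - Q * b))
    step = solve-∀

∣n⇒∣m*n : ∀ {k} m {z} → k ∣ z → k ∣ m * z
∣n⇒∣m*n {k} m {z} k∣z = ∣⇒∣ᵤ (Signed.∣n⇒∣m*n m (∣ᵤ⇒∣ {k} {z} k∣z))

coprime-∣m*z⇒∣z : ∀ {n} m {z} → Coprime n m → (+ n) ∣ + m * z → (+ n) ∣ z
coprime-∣m*z⇒∣z {n} m {z} n⊥m n∣mz = coprime-divisor n⊥m (subst (n ℕ.∣_) (abs-* (+ m) z) n∣mz)

coprime-∣m^k*z⇒∣z : ∀ {n} m k {z} → Coprime n m → (+ n) ∣ (+ m) ^ k * z → (+ n) ∣ z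
coprime-∣m^k*z⇒∣z m zero    {z} n⊥m n∣z = subst ((+ _) ∣_) (*-identityˡ z) n∣z
coprime-∣m^k*z⇒∣z m (suc k) {z} n⊥m n∣mmᵏz =
  coprime-∣m^k*z⇒∣z m k n⊥m
    (coprime-∣m*z⇒∣z m n⊥m (subst ((+ _) ∣_) (*-assoc (+ m) ((+ m) ^ k) z) n∣mmᵏz))

coprime-∣m^k*z⇔∣z : ∀ {n} m k {z} → Coprime n m → (+ n) ∣ (+ m) ^ k * z ⇔ (+ n) ∣ z
coprime-∣m^k*z⇔∣z {n} m k n⊥m = mk⇔ (coprime-∣m^k*z⇒∣z m k n⊥m) (∣n⇒∣m*n {+ n} ((+ m) ^ k))

U-5-5-even : ∀ m → U (+ 5) (+ 5) (m ℕ.* 2) ≡ (+ 5) ^ m * U 1ℤ (- 1ℤ) (m ℕ.* 2)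
U-5-5-even m = trans (sym (*-identityˡ _)) (U-twisted-even 1ℤ (- 1ℤ) m)

∣U-1-−1-even⇔∣U-5-5-even : ∀ {n} → Coprime n 5 → ∀ m →
  (+ n) ∣ U 1ℤ (- 1ℤ) (m ℕ.* 2) ⇔ (+ n) ∣ U (+ 5) (+ 5) (m ℕ.* 2)
∣U-1-−1-even⇔∣U-5-5-even n⊥5 m rewrite U-5-5-even m = ⇔-sym (coprime-∣m^k*z⇔∣z 5 m n⊥5)

odd⇒suc-even : ∀ n → ¬ 2 ℕ.∣ n → ∃[ k ] suc n ≡ k ℕ.* 2
odd⇒suc-even zero          2∤n = contradiction (ℕ.divides 0 refl) 2∤n
odd⇒suc-even (suc zero)    2∤n = 1 , refl
odd⇒suc-even (suc (suc n)) 2∤n = map suc (cong (suc ∘ suc)) (odd⇒suc-even n (2∤n ∘ ∣m∣n⇒∣m+n ∣-refl))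

paramsStar-preserves-⇔ : (Φ : ℤ → ℤ → Set) → (Φ 1ℤ (- 1ℤ) ⇔ Φ (+ 5) (+ 5)) →
  ∀ D → Φ 1ℤ (Qof D) ⇔ Φ (proj₁ (paramsStar D)) (proj₂ (paramsStar D))
paramsStar-preserves-⇔ Φ Φ-1-−1⇔Φ-5-5 D with Qof D ≟ - 1ℤ
... | yes Q≡−1 rewrite Q≡−1 = Φ-1-−1⇔Φ-5-5
... | no _ = mk⇔ id id

theorem3 : (n : ℕ) → 0 < n → Coprime n 10 → (LucasPrpA n ⇔ LucasPrpAStar n)
theorem3 n _ n⊥10 = mk⇔ (map₂ λ {j} → map₂ (Equivalence.to   (same-test (Dseq j))))
                        (map₂ λ {j} → map₂ (Equivalence.from (same-test (Dseq j))))
  where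
  n⊥5 : Coprime n 5
  n⊥5 (d∣n , d∣5) = n⊥10 (d∣n , ∣-trans d∣5 (ℕ.divides 2 refl))

  n-odd : ¬ 2 ℕ.∣ n
  n-odd 2∣n with n⊥10 (2∣n , ℕ.divides 5 refl)
  ... | ()

  n∣U : ℤ → ℤ → Set
  n∣U P Q = (+ n) ∣ U P Q (suc n)

  fibonacci⇔5-5 : n∣U 1ℤ (- 1ℤ) ⇔ n∣U (+ 5) (+ 5)
  fibonacci⇔5-5 =
    let k , suc-n≡k*2 = odd⇒suc-even n n-odd
    in subst (λ N → (+ n) ∣ U 1ℤ (- 1ℤ) N ⇔ (+ n) ∣ U (+ 5) (+ 5) N)
             (sym suc-n≡k*2) (∣U-1-−1-even⇔∣U-5-5-even n⊥5 k)

  same-test : ∀ D → n∣U 1ℤ (Qof D) ⇔ n∣U (proj₁ (paramsStar D)) (proj₂ (paramsStar D))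
  same-test = paramsStar-preserves-⇔ n∣U fibonacci⇔5-5
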